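{- Let $(S,d)$ be an asymmetric $k$-center instance with optimal radius $r^*$ and optimal clustering $\{C_1,\dots,C_k\}$, let $\alpha\ge1$, and let $\mathcal{C}$ be the clustering induced by a set of $k$ centers whose $k$-center cost is at most $\alpha r^*$. Then every optimal cluster that is $\alpha$-locally perturbation resilient is a cluster of $\mathcal{C}$; moreover this holds even for every optimal cluster that merely satisfies $\alpha$-local metric perturbation resilience.
   Context: An asymmetric $k$-center instance is a finite set $S$ with $d:S\times S\to\mathbb{R}_{\ge0}$ satisfying the metric axioms except symmetry (in particular the directed triangle inequality $d(u,w)\le d(u,v)+d(v,w)$); this includes ordinary symmetric $k$-center. For $X\subseteq S$ with $|X|=k$, the cost is $\max_{v\in S}\min_{x\in X}d(x,v)$, $r^*$ is the minimum cost, and the clustering induced by $X$ assigns each $v$ to the center $x\in X$ minimizing $d(x,v)$. For $\alpha\ge1$, an $\alpha$-perturbation of $d$ is any $d'$ with $d(u,v)\le d'(u,v)\le\alpha d(u,v)$ for all $u,v$; it is an $\alpha$-metric perturbation if in addition $d'$ satisfies the (directed) triangle inequality. An optimal cluster $C_i$ is $\alpha$-locally perturbation resilient (resp. $\alpha$-locally metric perturbation resilient) if for every $\alpha$-perturbation (resp. every $\alpha$-metric perturbation) $d'$, the optimal $k$-center clustering under $d'$ contains $C_i$ as one of its clusters.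
   Formalization: The distances d and the factor α, hence also r*, are rational instead of real. -}

module Defs where

open import Data.Nat using (ℕ)
open import Data.Fin using (Fin)
open import Data.Fin.Subset using (Subset; _∈_; ∣_∣)
open import Data.Rational using (ℚ; 0ℚ; _≤_; _*_; _+_)
open import Data.Product using (Σ; ∃; _×_)
open import Relation.Binary.PropositionalEquality using (_≡_)
open import Function.Bundles using (_⇔_)

Dist : ℕ → Set
Dist n = Fin n → Fin n → ℚ

Triangle : ∀ {n} → Dist n → Set
Triangle {n} d = ∀ (u v w : Fin n) → d u w ≤ d u v + d v w

IsAsymMetric : ∀ {n} → Dist n → Set
IsAsymMetric {n} d =
  (∀ (u v : Fin n) → 0ℚ ≤ d u v) ×
  (∀ (u : Fin n) → d u u ≡ 0ℚ) ×
  (∀ (u v : Fin n) → d u v ≡ 0ℚ → u ≡ v) ×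
  Triangle d

CostAtMost : ∀ {n} → Dist n → Subset n → ℚ → Set
CostAtMost {n} d X r = ∀ (v : Fin n) → ∃ λ (x : Fin n) → x ∈ X × d x v ≤ r

IsOptRadius : ∀ {n} → Dist n → ℕ → ℚ → Set
IsOptRadius {n} d k r =
  (∃ λ (X : Subset n) → ∣ X ∣ ≡ k × CostAtMost d X r) ×
  (∀ (X : Subset n) (r' : ℚ) → ∣ X ∣ ≡ k → CostAtMost d X r' → r ≤ r')

IsOptCenters : ∀ {n} → Dist n → ℕ → Subset n → Set
IsOptCenters {n} d k X = ∣ X ∣ ≡ k × ∃ λ (r : ℚ) → IsOptRadius d k r × CostAtMost d X r

-- a is an assignment realising the clustering induced by X under d:
-- every point goes to a center of X minimising d(x, v) (arbitrary tie-breaking).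
IsInducedAssignment : ∀ {n} → Dist n → Subset n → (Fin n → Fin n) → Set
IsInducedAssignment {n} d X a =
  ∀ (v : Fin n) → a v ∈ X × (∀ (x : Fin n) → x ∈ X → d (a v) v ≤ d x v)

IsClusterOf : ∀ {n} → Subset n → Subset n → (Fin n → Fin n) → Set
IsClusterOf {n} C X a = ∃ λ (c : Fin n) → c ∈ X × (∀ (v : Fin n) → (v ∈ C ⇔ a v ≡ c))

IsPerturbation : ∀ {n} → ℚ → Dist n → Dist n → Set
IsPerturbation {n} α d d' = ∀ (u v : Fin n) → d u v ≤ d' u v × d' u v ≤ α * d u v

IsMetricPerturbation : ∀ {n} → ℚ → Dist n → Dist n → Set
IsMetricPerturbation α d d' = IsPerturbation α d d' × Triangle d'

-- C is contained as a cluster in every optimal k-center clustering under d'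
-- (every optimal center set, every induced assignment / tie-breaking).
ClusterInAllOptimal : ∀ {n} → Dist n → ℕ → Subset n → Set
ClusterInAllOptimal {n} d' k C =
  ∀ (Y : Subset n) (b : Fin n → Fin n) →
    IsOptCenters d' k Y → IsInducedAssignment d' Y b → IsClusterOf C Y b

LocallyPR : ∀ {n} → ℚ → Dist n → ℕ → Subset n → Set
LocallyPR {n} α d k C = ∀ (d' : Dist n) → IsPerturbation α d d' → ClusterInAllOptimal d' k C

LocallyMetricPR : ∀ {n} → ℚ → Dist n → ℕ → Subset n → Set
LocallyMetricPR {n} α d k C = ∀ (d' : Dist n) → IsMetricPerturbation α d d' → ClusterInAllOptimal d' k C

{-# OPTIONS --safe #-}
-- Let X be k centers of cost at most α r*.  Stretch every distance t to
-- min (α t) (max (α r*) t): distances are multiplied by at most α, never shrink,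
-- and the triangle inequality survives.  Under the stretched distance X has cost
-- α r*, while a cost below α r* can only use distances that were multiplied by
-- exactly α, i.e. it comes from a cost below r* under d; so X is optimal.  Since
-- stretching is monotone the clustering induced by X is unchanged, and resilience
-- of C against this single metric perturbation makes C one of its clusters.
module Submission where

open import Defs
open import Data.Nat using (ℕ)
open import Data.Fin using (Fin)
open import Data.Fin.Subset using (Subset; ∣_∣)
open import Data.Rational
  using (ℚ; 0ℚ; 1ℚ; _≤_; _≰_; _+_; _*_; _÷_; 1/_; _⊓_; _⊔_
        ; Positive; NonNegative; NonZero; positive; nonNegative)
open import Data.Rational.Properties
open import Data.Product using (_×_; _,_)
open import Data.Sum using (inj₁; inj₂)
open import Data.Empty using (⊥-elim)
open import Relation.Nullary using (yes; no)
open import Relation.Binary.PropositionalEquality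
  using (_≡_; sym; cong; cong₂; subst; module ≡-Reasoning)

p≤p+q : ∀ {p q} → 0ℚ ≤ q → p ≤ p + q
p≤p+q {p} 0≤q = subst (_≤ p + _) (+-identityʳ p) (+-monoʳ-≤ p 0≤q)

p≤q+p : ∀ {p q} → 0ℚ ≤ q → p ≤ q + p
p≤q+p {p} {q} 0≤q = subst (p ≤_) (+-comm p q) (p≤p+q 0≤q)

module Stretch {α : ℚ} (1≤α : 1ℚ ≤ α) (β : ℚ) where

  instance
    α-positive : Positive α
    α-positive = positive (<-≤-trans (positive⁻¹ 1ℚ) 1≤α)

    α-nonNegative : NonNegative α
    α-nonNegative = pos⇒nonNeg α

    α-nonZero : NonZero α
    α-nonZero = pos⇒nonZero α

  α*[p÷α]≡p : ∀ p → α * (p ÷ α) ≡ p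
  α*[p÷α]≡p p = begin
    α * (p * 1/ α)   ≡⟨ *-comm α (p * 1/ α) ⟩
    p * 1/ α * α     ≡⟨ *-assoc p (1/ α) α ⟩
    p * (1/ α * α)   ≡⟨ cong (p *_) (*-inverseˡ α) ⟩
    p * 1ℚ           ≡⟨ *-identityʳ p ⟩
    p                ∎
    where open ≡-Reasoning

  p≤α*p : ∀ {p} → 0ℚ ≤ p → p ≤ α * p
  p≤α*p {p} 0≤p = subst (_≤ α * p) (*-identityˡ p) (*-monoʳ-≤-nonNeg p {{nonNegative 0≤p}} 1≤α)

  stretch : ℚ → ℚ
  stretch t = (α * t) ⊓ (β ⊔ t)

  stretch-lower : ∀ {t} → 0ℚ ≤ t → t ≤ stretch t
  stretch-lower {t} 0≤t = ⊓-glb (p≤α*p 0≤t) (p≤q⊔p β t)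

  stretch-nonNeg : ∀ {t} → 0ℚ ≤ t → 0ℚ ≤ stretch t
  stretch-nonNeg 0≤t = ≤-trans 0≤t (stretch-lower 0≤t)

  stretch-upper : ∀ t → stretch t ≤ α * t
  stretch-upper t = p⊓q≤p (α * t) (β ⊔ t)

  stretch-mono : ∀ {s t} → s ≤ t → stretch s ≤ stretch t
  stretch-mono s≤t = ⊓-mono-≤ (*-monoˡ-≤-nonNeg α s≤t) (⊔-monoʳ-≤ β s≤t)

  stretch-≤-aboveCap : ∀ {t r} → β ≤ r → t ≤ r → stretch t ≤ r
  stretch-≤-aboveCap {t} β≤r t≤r = p≤q⇒r⊓p≤q (α * t) (⊔-lub β≤r t≤r)

  stretch-≤-belowCap : ∀ {t r} → β ≰ r → stretch t ≤ r → α * t ≤ r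
  stretch-≤-belowCap {t} β≰r t≤r with ⊓-sel (α * t) (β ⊔ t)
  ... | inj₁ scaled = subst (_≤ _) scaled t≤r
  ... | inj₂ capped = ⊥-elim (β≰r (p⊔q≤r⇒p≤r β t (subst (_≤ _) capped t≤r)))

  capped⇒β≤stretch : ∀ {t} → stretch t ≡ β ⊔ t → β ≤ stretch t
  capped⇒β≤stretch {t} capped = subst (β ≤_) (sym capped) (p≤p⊔q β t)

  stretch-subadditive-aboveCap : ∀ {s t} → 0ℚ ≤ s → 0ℚ ≤ t →
    β ≤ stretch s + stretch t → stretch (s + t) ≤ stretch s + stretch t
  stretch-subadditive-aboveCap 0≤s 0≤t β≤ =
    stretch-≤-aboveCap β≤ (+-mono-≤ (stretch-lower 0≤s) (stretch-lower 0≤t))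

  -- Unless both s and t are scaled by α, the right-hand side already reaches the cap β.
  stretch-subadditive : ∀ {s t} → 0ℚ ≤ s → 0ℚ ≤ t → stretch (s + t) ≤ stretch s + stretch t
  stretch-subadditive {s} {t} 0≤s 0≤t with ⊓-sel (α * s) (β ⊔ s) | ⊓-sel (α * t) (β ⊔ t)
  ... | inj₁ s-scaled | inj₁ t-scaled = begin
    stretch (s + t)        ≤⟨ stretch-upper (s + t) ⟩
    α * (s + t)            ≡⟨ *-distribˡ-+ α s t ⟩
    α * s + α * t          ≡⟨ sym (cong₂ _+_ s-scaled t-scaled) ⟩
    stretch s + stretch t  ∎
    where open ≤-Reasoning
  ... | inj₂ s-capped | _ = stretch-subadditive-aboveCap 0≤s 0≤t
    (≤-trans (capped⇒β≤stretch s-capped) (p≤p+q (stretch-nonNeg 0≤t)))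
  ... | inj₁ _ | inj₂ t-capped = stretch-subadditive-aboveCap 0≤s 0≤t
    (≤-trans (capped⇒β≤stretch t-capped) (p≤q+p (stretch-nonNeg 0≤s)))

  stretchDist : ∀ {n} → Dist n → Dist n
  stretchDist d u v = stretch (d u v)

  module _ {n : ℕ} {d : Dist n} where

    stretch-isMetricPerturbation : (∀ u v → 0ℚ ≤ d u v) → Triangle d →
      IsMetricPerturbation α d (stretchDist d)
    stretch-isMetricPerturbation nonNeg triangle =
      (λ u v → stretch-lower (nonNeg u v) , stretch-upper (d u v)) ,
      (λ u v w → ≤-trans (stretch-mono (triangle u v w))
                         (stretch-subadditive (nonNeg u v) (nonNeg v w)))

    stretch-preservesInducedAssignment : ∀ {X a} →
      IsInducedAssignment d X a → IsInducedAssignment (stretchDist d) X a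
    stretch-preservesInducedAssignment induced v =
      let av∈X , av-closest = induced v
      in  av∈X , λ x x∈X → stretch-mono (av-closest x x∈X)

    stretch-preservesCost-atCap : ∀ {X} → CostAtMost d X β → CostAtMost (stretchDist d) X β
    stretch-preservesCost-atCap cost v =
      let x , x∈X , dxv≤β = cost v
      in  x , x∈X , stretch-≤-aboveCap ≤-refl dxv≤β

    stretch-reflectsCost-belowCap : ∀ {Y r} → β ≰ r →
      CostAtMost (stretchDist d) Y r → CostAtMost d Y (r ÷ α)
    stretch-reflectsCost-belowCap {r = r} β≰r cost v =
      let y , y∈Y , stretch≤r = cost v
      in  y , y∈Y , *-cancelˡ-≤-pos α
            (subst (_ ≤_) (sym (α*[p÷α]≡p r)) (stretch-≤-belowCap β≰r stretch≤r))

module _ {n k : ℕ} {d : Dist n} {α rstar : ℚ} (1≤α : 1ℚ ≤ α) where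
  open Stretch 1≤α (α * rstar)

  approxCenters-optimalUnderStretch : IsOptRadius d k rstar →
    ∀ {X} → ∣ X ∣ ≡ k → CostAtMost d X (α * rstar) → IsOptCenters (stretchDist d) k X
  approxCenters-optimalUnderStretch (_ , rstar-minimal) {X} ∣X∣≡k cost =
    ∣X∣≡k , α * rstar , ((X , ∣X∣≡k , stretchedCost) , α*rstar-minimal) , stretchedCost
    where
    stretchedCost : CostAtMost (stretchDist d) X (α * rstar)
    stretchedCost = stretch-preservesCost-atCap cost

    α*rstar-minimal : ∀ Y r → ∣ Y ∣ ≡ k → CostAtMost (stretchDist d) Y r → α * rstar ≤ r
    α*rstar-minimal Y r ∣Y∣≡k costY with α * rstar ≤? r
    ... | yes α*rstar≤r = α*rstar≤r
    ... | no  α*rstar≰r = subst (α * rstar ≤_) (α*[p÷α]≡p r) (*-monoˡ-≤-nonNeg α rstar≤r÷α)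
      where
      rstar≤r÷α : rstar ≤ r ÷ α
      rstar≤r÷α = rstar-minimal Y (r ÷ α) ∣Y∣≡k (stretch-reflectsCost-belowCap α*rstar≰r costY)

module _ {n k : ℕ} {d : Dist n} {α : ℚ} {C : Subset n} where

  locallyPR⇒locallyMetricPR : LocallyPR α d k C → LocallyMetricPR α d k C
  locallyPR⇒locallyMetricPR resilient d′ (perturbation , _) = resilient d′ perturbation

  locallyMetricPR⇒clusterOfApprox : ∀ {rstar X a} →
    IsAsymMetric d → 1ℚ ≤ α → IsOptRadius d k rstar →
    ∣ X ∣ ≡ k → CostAtMost d X (α * rstar) → IsInducedAssignment d X a →
    LocallyMetricPR α d k C → IsClusterOf C X a
  locallyMetricPR⇒clusterOfApprox {rstar} {X} {a}
    (nonNeg , _ , _ , triangle) 1≤α opt ∣X∣≡k cost induced resilient =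
    resilient (stretchDist d) (stretch-isMetricPerturbation nonNeg triangle) X a
      (approxCenters-optimalUnderStretch 1≤α opt ∣X∣≡k cost)
      (stretch-preservesInducedAssignment induced)
    where open Stretch 1≤α (α * rstar)

theorem2 : ∀ (n k : ℕ) (d : Dist n) (α rstar : ℚ) →
    IsAsymMetric d → 1ℚ ≤ α → IsOptRadius d k rstar →
    ∀ (Xopt : Subset n) (aopt : Fin n → Fin n) →
      ∣ Xopt ∣ ≡ k → CostAtMost d Xopt rstar → IsInducedAssignment d Xopt aopt →
    ∀ (X : Subset n) (a : Fin n → Fin n) →
      ∣ X ∣ ≡ k → CostAtMost d X (α * rstar) → IsInducedAssignment d X a →
    ∀ (C : Subset n) → IsClusterOf C Xopt aopt →
      (LocallyPR α d k C → IsClusterOf C X a) ×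
      (LocallyMetricPR α d k C → IsClusterOf C X a)
theorem2 n k d α rstar metric 1≤α opt _ _ _ _ _ X a ∣X∣≡k cost induced C _ =
  (λ resilient → clusterOfApprox (locallyPR⇒locallyMetricPR {α = α} resilient)) , clusterOfApprox
  where
  clusterOfApprox : LocallyMetricPR α d k C → IsClusterOf C X a
  clusterOfApprox = locallyMetricPR⇒clusterOfApprox metric 1≤α opt ∣X∣≡k cost induced
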